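{- If $L$ is a finite graded trim lattice, then $L$ contains no sublattice isomorphic to $N_5$.
   Context: $N_5$ is the five-element lattice $\{\hat0<x<y<\hat1,\ \hat0<z<\hat1\}$ with $z$ incomparable to $x$ and $y$; a sublattice is a subset closed under $\vee$ and $\wedge$. A lattice is graded if all maximal chains in any given interval have the same cardinality. An element $x$ of a lattice $L$ is left modular if for all $y<z$ in $L$, $(y\vee x)\wedge z=y\vee(x\wedge z)$. A join-irreducible is an element other than $\hat0$ that is not the join of two strictly smaller elements; a meet-irreducible is an element other than $\hat1$ that is not the meet of two strictly larger elements. A lattice is trim if, for some $n$, it has a maximal chain of $n+1$ left modular elements and exactly $n$ join-irreducibles and exactly $n$ meet-irreducibles. -}

module Defs where

open import Data.Nat using (ℕ; suc)
open import Data.Fin using (Fin)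
open import Data.Fin.Subset using (Subset; _∈_; _⊆_; ∣_∣)
open import Data.Product using (Σ; ∃; ∃-syntax; _×_; _,_)
open import Data.Sum using (_⊎_)
open import Relation.Nullary using (¬_)
open import Relation.Binary.PropositionalEquality using (_≡_; _≢_)
open import Relation.Binary.Lattice.Structures using (IsLattice)
open import Function.Definitions using (Injective)

record FiniteLattice : Set₁ where
  field
    size      : ℕ
    _≤_       : Fin size → Fin size → Set
    _∨_       : Fin size → Fin size → Fin size
    _∧_       : Fin size → Fin size → Fin size
    isLattice : IsLattice _≡_ _≤_ _∨_ _∧_

module _ (L : FiniteLattice) where
  open FiniteLattice L

  Elt : Set
  Elt = Fin size

  _<_ : Elt → Elt → Set
  a < b = a ≤ b × a ≢ b

  IsChainIn : Elt → Elt → Subset size → Set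
  IsChainIn a b C =
    (∀ x → x ∈ C → a ≤ x × x ≤ b) × (∀ x y → x ∈ C → y ∈ C → x ≤ y ⊎ y ≤ x)

  IsMaximalChainIn : Elt → Elt → Subset size → Set
  IsMaximalChainIn a b C =
    IsChainIn a b C × (∀ D → IsChainIn a b D → C ⊆ D → D ⊆ C)

  IsBottom : Elt → Set
  IsBottom x = ∀ y → x ≤ y

  IsTop : Elt → Set
  IsTop x = ∀ y → y ≤ x

  IsMaximalChain : Subset size → Set
  IsMaximalChain C = ∃[ a ] ∃[ b ] (IsBottom a × IsTop b × IsMaximalChainIn a b C)

  Graded : Set
  Graded = ∀ a b C D → IsMaximalChainIn a b C → IsMaximalChainIn a b D → ∣ C ∣ ≡ ∣ D ∣

  LeftModular : Elt → Set
  LeftModular x = ∀ y z → y < z → ((y ∨ x) ∧ z) ≡ (y ∨ (x ∧ z))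

  JoinIrreducible : Elt → Set
  JoinIrreducible x = ¬ IsBottom x × ¬ (∃[ y ] ∃[ z ] (y < x × z < x × x ≡ (y ∨ z)))

  MeetIrreducible : Elt → Set
  MeetIrreducible x = ¬ IsTop x × ¬ (∃[ y ] ∃[ z ] (x < y × x < z × x ≡ (y ∧ z)))

  _IsSetOf_ : Subset size → (Elt → Set) → Set
  S IsSetOf P = ∀ x → (x ∈ S → P x) × (P x → x ∈ S)

  Trim : Set
  Trim = ∃[ n ]
    ( (∃[ C ] (IsMaximalChain C × ∣ C ∣ ≡ suc n × (∀ x → x ∈ C → LeftModular x)))
    × (∃[ J ] (J IsSetOf JoinIrreducible × ∣ J ∣ ≡ n))
    × (∃[ M ] (M IsSetOf MeetIrreducible × ∣ M ∣ ≡ n)) )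

-- The lattice N5 : 0 < x < y < 1, 0 < z < 1, z incomparable to x, y.
data N5 : Set where
  n0 nx ny nz n1 : N5

_∨₅_ : N5 → N5 → N5
n0 ∨₅ b = b
a ∨₅ n0 = a
n1 ∨₅ b = n1
a ∨₅ n1 = n1
nx ∨₅ nx = nx
nx ∨₅ ny = ny
ny ∨₅ nx = ny
ny ∨₅ ny = ny
nz ∨₅ nz = nz
nx ∨₅ nz = n1
ny ∨₅ nz = n1
nz ∨₅ nx = n1
nz ∨₅ ny = n1

_∧₅_ : N5 → N5 → N5
n1 ∧₅ b = b
a ∧₅ n1 = a
n0 ∧₅ b = n0
a ∧₅ n0 = n0
nx ∧₅ nx = nx
nx ∧₅ ny = nx
ny ∧₅ nx = nx
ny ∧₅ ny = ny
nz ∧₅ nz = nz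
nx ∧₅ nz = n0
ny ∧₅ nz = n0
nz ∧₅ nx = n0
nz ∧₅ ny = n0

-- L has a sublattice isomorphic to N5: an injective map N5 → L preserving ∨ and ∧
-- (its image is then a sublattice, isomorphic to N5 via this map).
HasN5Sublattice : FiniteLattice → Set
HasN5Sublattice L =
  Σ (N5 → Fin size) λ f →
    Injective _≡_ _≡_ f
    × (∀ a b → f (a ∨₅ b) ≡ (f a ∨ f b))
    × (∀ a b → f (a ∧₅ b) ≡ (f a ∧ f b))
  where open FiniteLattice L

-- For a set J containing all join-irreducibles, rank J a = ∣ J ∩ ↓ a ∣ is strictly monotone
-- (if b ≰ a, some join-irreducible lies below b but not below a) and supermodular; dually
-- for a set M containing all meet-irreducibles and ∣ M ∩ ↑ a ∣.  Take a maximal chain D through a; in a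
-- graded lattice it has n + 1 elements like the given one.  Being injective on D, rank J
-- maps D ∩ ↓ a into [0, rank J a] and D ∩ ↑ a into [rank J a, n], and dually for M; as
-- ∣ D ∩ ↓ a ∣ + ∣ D ∩ ↑ a ∣ = n + 2, all four bounds are tight, which forces
-- ∣ J ∩ ↓ a ∣ + ∣ M ∩ ↑ a ∣ = n.  So rank J is also submodular: a strictly monotone
-- valuation.  That rules out N5, where x < y have the same join and the same meet with z.
module Submission where

open import Defs hiding (_<_)
import Defs

open import Data.Nat using (ℕ; zero; suc; _+_; _∸_; z≤n; s≤s; s≤s⁻¹) renaming (_≤_ to _≤ℕ_; _<_ to _<ℕ_)
import Data.Nat.Properties as ℕ
open import Algebra.Properties.CommutativeSemigroup ℕ.+-commutativeSemigroup using () renaming (interchange to +-interchange)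
open import Data.Fin using (Fin; _≟_)
open import Data.Fin.Properties using (any?; all?)
open import Data.Fin.Subset using (Subset; inside; outside; _∈_; _∉_; _⊆_; _⊂_; _⊃_; _∩_; _∪_; ⁅_⁆; ∣_∣)
open import Data.Fin.Subset.Properties
  using (_∈?_; p⊆p∪q; Empty-unique; ⊆-antisym; p∩q⊆p; ∣p∩q∣≤∣p∣; p⊂q⇒∣p∣<∣q∣; ∣⊥∣≡0; ∣⁅x⁆∣≡1; x∈⁅x⁆; x∈⁅y⁆⇒x≡y; x∈p∩q⁺; x∈p∩q⁻; x∈p∪q⁺; x∈p∪q⁻; p⊆q⇒∣p∣≤∣q∣)
open import Data.Vec using (_∷_; []; tabulate)
open import Data.Vec.Properties using (lookup∘tabulate; lookup⇒[]=; []=⇒lookup; tabulate-cong)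
open import Data.Product using (∃-syntax; _×_; _,_; proj₁; proj₂; map₂)
open import Data.Sum as Sum using (_⊎_; inj₁; inj₂; [_,_]′)
open import Function using (_∘_; id; flip)
open import Level using (Level)
open import Relation.Nullary using (¬_; Dec; yes; no; does; ¬?; _×-dec_; _⊎-dec_; _→-dec_)
open import Relation.Nullary.Decidable using (dec-true; does-≡; map′)
open import Relation.Unary using (Pred; Decidable)
open import Relation.Binary.Lattice.Structures using (IsLattice)
open import Relation.Binary.Lattice.Properties.Lattice using (∧-∨-isLattice)
open import Induction.WellFounded using (WellFounded; Acc; acc; module Subrelation)
import Relation.Binary.Construct.On as On
open import Data.Fin.Subset.Induction using (⊂-wellFounded; ⊃-wellFounded)
open import Data.Empty using (⊥-elim)
open import Relation.Binary.PropositionalEquality using (_≡_; _≢_; refl; sym; trans; cong; cong₂; subst; subst₂; module ≡-Reasoning)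

private variable
  ℓ : Level
  n : ℕ
  B : Set ℓ

⟦_⟧ : {P : Pred (Fin n) ℓ} → Decidable P → Subset n
⟦ P? ⟧ = tabulate (does ∘ P?)

module _ {P : Pred (Fin n) ℓ} (P? : Decidable P) where

  x∈⟦P?⟧⁺ : ∀ {x} → P x → x ∈ ⟦ P? ⟧
  x∈⟦P?⟧⁺ {x} px = lookup⇒[]= x ⟦ P? ⟧ (trans (lookup∘tabulate (does ∘ P?) x) (dec-true (P? x) px))

  x∈⟦P?⟧⁻ : ∀ {x} → x ∈ ⟦ P? ⟧ → P x
  x∈⟦P?⟧⁻ {x} x∈ with P? x | trans (sym (lookup∘tabulate (does ∘ P?) x)) ([]=⇒lookup x∈)
  ... | yes px | _ = px
  ... | no _   | ()

  ⟦P?⟧≡⟦Q?⟧ : (Q? : Decidable P) → ⟦ P? ⟧ ≡ ⟦ Q? ⟧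
  ⟦P?⟧≡⟦Q?⟧ Q? = tabulate-cong (λ x → does-≡ (P? x) (Q? x))

∣p∪q∣+∣p∩q∣≡∣p∣+∣q∣ : (p q : Subset n) → ∣ p ∪ q ∣ + ∣ p ∩ q ∣ ≡ ∣ p ∣ + ∣ q ∣
∣p∪q∣+∣p∩q∣≡∣p∣+∣q∣ []            []            = refl
∣p∪q∣+∣p∩q∣≡∣p∣+∣q∣ (inside  ∷ p) (inside  ∷ q) =
  cong suc (trans (ℕ.+-suc _ _) (trans (cong suc (∣p∪q∣+∣p∩q∣≡∣p∣+∣q∣ p q)) (sym (ℕ.+-suc _ _))))
∣p∪q∣+∣p∩q∣≡∣p∣+∣q∣ (inside  ∷ p) (outside ∷ q) = cong suc (∣p∪q∣+∣p∩q∣≡∣p∣+∣q∣ p q)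
∣p∪q∣+∣p∩q∣≡∣p∣+∣q∣ (outside ∷ p) (inside  ∷ q) =
  trans (cong suc (∣p∪q∣+∣p∩q∣≡∣p∣+∣q∣ p q)) (sym (ℕ.+-suc _ _))
∣p∪q∣+∣p∩q∣≡∣p∣+∣q∣ (outside ∷ p) (outside ∷ q) = ∣p∪q∣+∣p∩q∣≡∣p∣+∣q∣ p q

∣p∪q∣≤∣p∣+∣q∣ : (p q : Subset n) → ∣ p ∪ q ∣ ≤ℕ ∣ p ∣ + ∣ q ∣
∣p∪q∣≤∣p∣+∣q∣ p q = subst (∣ p ∪ q ∣ ≤ℕ_) (∣p∪q∣+∣p∩q∣≡∣p∣+∣q∣ p q) (ℕ.m≤m+n _ _)

x∈p∪⁅y⁆⁻ : ∀ (p : Subset n) {x y} → x ∈ p ∪ ⁅ y ⁆ → x ∈ p ⊎ x ≡ y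
x∈p∪⁅y⁆⁻ p {y = y} = Sum.map₂ (x∈⁅y⁆⇒x≡y y) ∘ x∈p∪q⁻ p ⁅ y ⁆

empty⇒∣p∣≡0 : {p : Subset n} → (∀ x → x ∉ p) → ∣ p ∣ ≡ 0
empty⇒∣p∣≡0 {n} x∉p = trans (cong ∣_∣ (Empty-unique λ (x , x∈p) → x∉p x x∈p)) (∣⊥∣≡0 n)

InjectiveOn : (Fin n → B) → Subset n → Set _
InjectiveOn f S = ∀ {x y} → x ∈ S → y ∈ S → f x ≡ f y → x ≡ y

injectiveOn-⊆ : {f : Fin n → B} {S T : Subset n} → S ⊆ T → InjectiveOn f T → InjectiveOn f S
injectiveOn-⊆ S⊆T inj x∈S y∈S = inj (S⊆T x∈S) (S⊆T y∈S)

injectiveOn⇒∣S∣≤k : (f : Fin n → ℕ) → ∀ k {lo} (S : Subset n) → InjectiveOn f S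
  → (∀ {x} → x ∈ S → lo ≤ℕ f x × f x <ℕ lo + k) → ∣ S ∣ ≤ℕ k
injectiveOn⇒∣S∣≤k f zero {lo} S _ range = ℕ.≤-reflexive (empty⇒∣p∣≡0 λ x x∈S →
  ℕ.<⇒≱ (subst (f x <ℕ_) (ℕ.+-identityʳ lo) (proj₂ (range x∈S))) (proj₁ (range x∈S)))
injectiveOn⇒∣S∣≤k f (suc k) {lo} S inj range =
  ℕ.≤-trans ∣S∣≤1+∣T∣ (s≤s (injectiveOn⇒∣S∣≤k f k T (injectiveOn-⊆ T⊆S inj) T-range))
  where
  ≢lo? : Decidable (λ x → f x ≢ lo)
  ≢lo? x = ¬? (f x ℕ.≟ lo)

  T : Subset _
  T = S ∩ ⟦ ≢lo? ⟧

  T⊆S : T ⊆ S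
  T⊆S = p∩q⊆p S ⟦ ≢lo? ⟧

  T-range : ∀ {x} → x ∈ T → suc lo ≤ℕ f x × f x <ℕ suc lo + k
  T-range {x} x∈T with x∈p∩q⁻ S ⟦ ≢lo? ⟧ x∈T
  ... | x∈S , x∈≢lo = ℕ.≤∧≢⇒< (proj₁ (range x∈S)) (x∈⟦P?⟧⁻ ≢lo? x∈≢lo ∘ sym)
                    , subst (f x <ℕ_) (ℕ.+-suc lo k) (proj₂ (range x∈S))

  ∣S∣≤1+∣T∣ : ∣ S ∣ ≤ℕ suc ∣ T ∣
  ∣S∣≤1+∣T∣ with any? (λ x → x ∈? S ×-dec f x ℕ.≟ lo)
  ... | no ∄ = ℕ.m≤n⇒m≤1+n (p⊆q⇒∣p∣≤∣q∣ λ {x} x∈S → x∈p∩q⁺ (x∈S , x∈⟦P?⟧⁺ ≢lo? λ fx≡lo → ∄ (x , x∈S , fx≡lo)))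
  ... | yes (s , s∈S , fs≡lo) = begin
    ∣ S ∣              ≤⟨ p⊆q⇒∣p∣≤∣q∣ S⊆⁅s⁆∪T ⟩
    ∣ ⁅ s ⁆ ∪ T ∣      ≤⟨ ∣p∪q∣≤∣p∣+∣q∣ ⁅ s ⁆ T ⟩
    ∣ ⁅ s ⁆ ∣ + ∣ T ∣  ≡⟨ cong (_+ ∣ T ∣) (∣⁅x⁆∣≡1 s) ⟩
    suc ∣ T ∣          ∎
    where
    open ℕ.≤-Reasoning
    S⊆⁅s⁆∪T : S ⊆ ⁅ s ⁆ ∪ T
    S⊆⁅s⁆∪T {x} x∈S with f x ℕ.≟ lo
    ... | yes fx≡lo = x∈p∪q⁺ (inj₁ (subst (_∈ ⁅ s ⁆) (sym (inj x∈S s∈S (trans fx≡lo (sym fs≡lo)))) (x∈⁅x⁆ s)))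
    ... | no fx≢lo  = x∈p∪q⁺ (inj₂ (x∈p∩q⁺ (x∈S , x∈⟦P?⟧⁺ ≢lo? fx≢lo)))

injectiveOn⇒lo+∣S∣≤hi : (f : Fin n → ℕ) (S : Subset n) → InjectiveOn f S → ∀ {lo hi} → lo ≤ℕ hi
  → (∀ {x} → x ∈ S → lo ≤ℕ f x × f x <ℕ hi) → lo + ∣ S ∣ ≤ℕ hi
injectiveOn⇒lo+∣S∣≤hi f S inj {lo} {hi} lo≤hi range =
  subst (lo + ∣ S ∣ ≤ℕ_) lo+[hi∸lo]≡hi (ℕ.+-monoʳ-≤ lo (injectiveOn⇒∣S∣≤k f (hi ∸ lo) S inj
    λ x∈S → proj₁ (range x∈S) , subst (_ <ℕ_) (sym lo+[hi∸lo]≡hi) (proj₂ (range x∈S))))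
  where
  lo+[hi∸lo]≡hi : lo + (hi ∸ lo) ≡ hi
  lo+[hi∸lo]≡hi = ℕ.m+[n∸m]≡n lo≤hi

module FiniteLatticeProperties (L : FiniteLattice) where
  open FiniteLattice L
  open IsLattice isLattice
    using (antisym; x≤x∨y; y≤x∨y; ∨-least; ∧-greatest) renaming (refl to ≤-refl; trans to ≤-trans)

  infix 4 _<_ _≤?_ _<?_

  _<_ : Elt L → Elt L → Set
  _<_ = Defs._<_ L

  _≤?_ : (x y : Elt L) → Dec (x ≤ y)
  x ≤? y = map′ (λ x∨y≡y → subst (x ≤_) x∨y≡y (x≤x∨y x y)) (λ x≤y → antisym (∨-least x≤y ≤-refl) (y≤x∨y x y)) (x ∨ y ≟ y)

  _<?_ : (x y : Elt L) → Dec (x < y)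
  x <? y = x ≤? y ×-dec ¬? (x ≟ y)

  ↓_ ↑_ : Elt L → Subset size
  ↓ a = ⟦ _≤? a ⟧
  ↑ a = ⟦ a ≤?_ ⟧

  module _ {S : Subset size} {a x : Elt L} where

    x∈S∩↓a⁺ : x ∈ S → x ≤ a → x ∈ S ∩ ↓ a
    x∈S∩↓a⁺ x∈S x≤a = x∈p∩q⁺ (x∈S , x∈⟦P?⟧⁺ (_≤? a) x≤a)

    x∈S∩↓a⁻ : x ∈ S ∩ ↓ a → x ∈ S × x ≤ a
    x∈S∩↓a⁻ x∈ = map₂ (x∈⟦P?⟧⁻ (_≤? a)) (x∈p∩q⁻ S (↓ a) x∈)

    x∈S∩↑a⁺ : x ∈ S → a ≤ x → x ∈ S ∩ ↑ a
    x∈S∩↑a⁺ x∈S a≤x = x∈p∩q⁺ (x∈S , x∈⟦P?⟧⁺ (a ≤?_) a≤x)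

    x∈S∩↑a⁻ : x ∈ S ∩ ↑ a → x ∈ S × a ≤ x
    x∈S∩↑a⁻ x∈ = map₂ (x∈⟦P?⟧⁻ (a ≤?_)) (x∈p∩q⁻ S (↑ a) x∈)

  S∩↓-mono : ∀ S {a b} → a ≤ b → S ∩ ↓ a ⊆ S ∩ ↓ b
  S∩↓-mono S a≤b x∈ = let x∈S , x≤a = x∈S∩↓a⁻ x∈ in x∈S∩↓a⁺ x∈S (≤-trans x≤a a≤b)

  <-wellFounded : WellFounded _<_
  <-wellFounded = Subrelation.wellFounded ↓-strict (On.wellFounded ↓_ ⊂-wellFounded)
    where
    ↓-strict : ∀ {a b} → a < b → ↓ a ⊂ ↓ b
    ↓-strict {a} {b} (a≤b , a≢b) = (λ x∈↓a → x∈⟦P?⟧⁺ (_≤? b) (≤-trans (x∈⟦P?⟧⁻ (_≤? a) x∈↓a) a≤b))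
      , b , x∈⟦P?⟧⁺ (_≤? b) ≤-refl , λ b∈↓a → a≢b (antisym a≤b (x∈⟦P?⟧⁻ (_≤? a) b∈↓a))

  joinIrreducible-separating : ∀ {a} b → ¬ b ≤ a → ∃[ j ] (JoinIrreducible L j × j ≤ b × ¬ j ≤ a)
  joinIrreducible-separating {a} b = go b (<-wellFounded b)
    where
    Separating : Elt L → Set
    Separating b = ∃[ j ] (JoinIrreducible L j × j ≤ b × ¬ j ≤ a)

    separating-mono : ∀ {y b} → y ≤ b → Separating y → Separating b
    separating-mono y≤b (j , j-irr , j≤y , j≰a) = j , j-irr , ≤-trans j≤y y≤b , j≰a

    go : ∀ b → Acc _<_ b → ¬ b ≤ a → Separating b
    go b (acc rs) b≰a with any? (λ y → any? (λ z → y <? b ×-dec z <? b ×-dec b ≟ y ∨ z))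
    ... | no b-irreducible = b , ((λ b-bottom → b≰a (b-bottom a)) , b-irreducible) , ≤-refl , b≰a
    ... | yes (y , z , y<b , z<b , b≡y∨z) with y ≤? a | z ≤? a
    ...   | no y≰a | _       = separating-mono (proj₁ y<b) (go y (rs y<b) y≰a)
    ...   | yes _  | no z≰a  = separating-mono (proj₁ z<b) (go z (rs z<b) z≰a)
    ...   | yes y≤a | yes z≤a = ⊥-elim (b≰a (subst (_≤ a) (sym b≡y∨z) (∨-least y≤a z≤a)))

  rank : Subset size → Elt L → ℕ
  rank J a = ∣ J ∩ ↓ a ∣

  rank-mono : ∀ J {a b} → a ≤ b → rank J a ≤ℕ rank J b
  rank-mono J a≤b = p⊆q⇒∣p∣≤∣q∣ (S∩↓-mono J a≤b)

  rank≤∣J∣ : ∀ J a → rank J a ≤ℕ ∣ J ∣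
  rank≤∣J∣ J a = ∣p∩q∣≤∣p∣ J (↓ a)

  rank-strict : ∀ {J} → (∀ j → JoinIrreducible L j → j ∈ J) → ∀ {a b} → a < b → rank J a <ℕ rank J b
  rank-strict {J} JI⊆J {a} {b} (a≤b , a≢b) with joinIrreducible-separating b (λ b≤a → a≢b (antisym a≤b b≤a))
  ... | j , j-irr , j≤b , j≰a =
    p⊂q⇒∣p∣<∣q∣ (S∩↓-mono J a≤b , j , x∈S∩↓a⁺ (JI⊆J j j-irr) j≤b , λ j∈ → j≰a (proj₂ (x∈S∩↓a⁻ j∈)))

  Supermodular : (Elt L → ℕ) → Set
  Supermodular v = ∀ a b → v a + v b ≤ℕ v (a ∨ b) + v (a ∧ b)

  rank-supermodular : ∀ J → Supermodular (rank J)
  rank-supermodular J a b = begin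
    rank J a + rank J b                                  ≡⟨ ∣p∪q∣+∣p∩q∣≡∣p∣+∣q∣ (J ∩ ↓ a) (J ∩ ↓ b) ⟨
    ∣ J ∩ ↓ a ∪ J ∩ ↓ b ∣ + ∣ (J ∩ ↓ a) ∩ (J ∩ ↓ b) ∣  ≤⟨ ℕ.+-mono-≤ (p⊆q⇒∣p∣≤∣q∣ ∪⊆) (p⊆q⇒∣p∣≤∣q∣ ∩⊆) ⟩
    rank J (a ∨ b) + rank J (a ∧ b)                      ∎
    where
    open ℕ.≤-Reasoning
    ∪⊆ : J ∩ ↓ a ∪ J ∩ ↓ b ⊆ J ∩ ↓ (a ∨ b)
    ∪⊆ x∈ with x∈p∪q⁻ (J ∩ ↓ a) (J ∩ ↓ b) x∈
    ... | inj₁ x∈↓a = S∩↓-mono J (x≤x∨y a b) x∈↓a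
    ... | inj₂ x∈↓b = S∩↓-mono J (y≤x∨y a b) x∈↓b
    ∩⊆ : (J ∩ ↓ a) ∩ (J ∩ ↓ b) ⊆ J ∩ ↓ (a ∧ b)
    ∩⊆ x∈ with x∈p∩q⁻ (J ∩ ↓ a) (J ∩ ↓ b) x∈
    ... | x∈↓a , x∈↓b = x∈S∩↓a⁺ (proj₁ (x∈S∩↓a⁻ x∈↓a)) (∧-greatest (proj₂ (x∈S∩↓a⁻ x∈↓a)) (proj₂ (x∈S∩↓a⁻ x∈↓b)))

  Comparable : Elt L → Elt L → Set
  Comparable x y = x ≤ y ⊎ y ≤ x

  IsChain : Subset size → Set
  IsChain C = ∀ x y → x ∈ C → y ∈ C → Comparable x y

  module _ {J C : Subset size} (JI⊆J : ∀ j → JoinIrreducible L j → j ∈ J) (C-chain : IsChain C) where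

    rank-injectiveOn-chain : InjectiveOn (rank J) C
    rank-injectiveOn-chain {x} {y} x∈C y∈C rx≡ry with x ≟ y | C-chain x y x∈C y∈C
    ... | yes x≡y | _       = x≡y
    ... | no x≢y  | inj₁ x≤y = ⊥-elim (ℕ.<-irrefl rx≡ry (rank-strict JI⊆J (x≤y , x≢y)))
    ... | no x≢y  | inj₂ y≤x = ⊥-elim (ℕ.<-irrefl (sym rx≡ry) (rank-strict JI⊆J (y≤x , x≢y ∘ sym)))

    ∣C∩↓a∣≤1+rank : ∀ a → ∣ C ∩ ↓ a ∣ ≤ℕ suc (rank J a)
    ∣C∩↓a∣≤1+rank a = injectiveOn⇒lo+∣S∣≤hi (rank J) (C ∩ ↓ a) (injectiveOn-⊆ (p∩q⊆p C (↓ a)) rank-injectiveOn-chain) z≤n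
      λ x∈ → z≤n , s≤s (rank-mono J (proj₂ (x∈S∩↓a⁻ x∈)))

    rank+∣C∩↑a∣≤1+∣J∣ : ∀ a → rank J a + ∣ C ∩ ↑ a ∣ ≤ℕ suc ∣ J ∣
    rank+∣C∩↑a∣≤1+∣J∣ a = injectiveOn⇒lo+∣S∣≤hi (rank J) (C ∩ ↑ a) (injectiveOn-⊆ (p∩q⊆p C (↑ a)) rank-injectiveOn-chain)
      (ℕ.m≤n⇒m≤1+n (rank≤∣J∣ J a)) λ {x} x∈ → rank-mono J (proj₂ (x∈S∩↑a⁻ x∈)) , s≤s (rank≤∣J∣ J x)

  ∣C∩↓a∣+∣C∩↑a∣≡1+∣C∣ : ∀ {C a} → IsChain C → a ∈ C → ∣ C ∩ ↓ a ∣ + ∣ C ∩ ↑ a ∣ ≡ suc ∣ C ∣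
  ∣C∩↓a∣+∣C∩↑a∣≡1+∣C∣ {C} {a} C-chain a∈C = begin
    ∣ C ∩ ↓ a ∣ + ∣ C ∩ ↑ a ∣                               ≡⟨ ∣p∪q∣+∣p∩q∣≡∣p∣+∣q∣ (C ∩ ↓ a) (C ∩ ↑ a) ⟨
    ∣ C ∩ ↓ a ∪ C ∩ ↑ a ∣ + ∣ (C ∩ ↓ a) ∩ (C ∩ ↑ a) ∣     ≡⟨ cong₂ _+_ (cong ∣_∣ ∪≡C) (trans (cong ∣_∣ ∩≡a) (∣⁅x⁆∣≡1 a)) ⟩
    ∣ C ∣ + 1                                               ≡⟨ ℕ.+-comm ∣ C ∣ 1 ⟩
    suc ∣ C ∣                                               ∎
    where
    open ≡-Reasoning
    ∪≡C : C ∩ ↓ a ∪ C ∩ ↑ a ≡ C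
    ∪≡C = ⊆-antisym
      (λ x∈ → [ (proj₁ ∘ x∈S∩↓a⁻) , (proj₁ ∘ x∈S∩↑a⁻) ]′ (x∈p∪q⁻ (C ∩ ↓ a) (C ∩ ↑ a) x∈))
      (λ {x} x∈C → x∈p∪q⁺ (Sum.map (x∈S∩↓a⁺ x∈C) (x∈S∩↑a⁺ x∈C) (C-chain x a x∈C a∈C)))
    ∩≡a : (C ∩ ↓ a) ∩ (C ∩ ↑ a) ≡ ⁅ a ⁆
    ∩≡a = ⊆-antisym
      (λ {x} x∈ → let x∈↓a , x∈↑a = x∈p∩q⁻ (C ∩ ↓ a) (C ∩ ↑ a) x∈ in
        subst (_∈ ⁅ a ⁆) (antisym (proj₂ (x∈S∩↑a⁻ x∈↑a)) (proj₂ (x∈S∩↓a⁻ x∈↓a))) (x∈⁅x⁆ a))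
      (λ {x} x∈⁅a⁆ → subst (_∈ (C ∩ ↓ a) ∩ (C ∩ ↑ a)) (sym (x∈⁅y⁆⇒x≡y a x∈⁅a⁆))
        (x∈p∩q⁺ (x∈S∩↓a⁺ a∈C ≤-refl , x∈S∩↑a⁺ a∈C ≤-refl)))

  Saturated : Subset size → Set
  Saturated C = ∀ x → (∀ y → y ∈ C → Comparable x y) → x ∈ C

  ⁅a⁆-chain : ∀ a → IsChain ⁅ a ⁆
  ⁅a⁆-chain a x y x∈ y∈ rewrite x∈⁅y⁆⇒x≡y a x∈ | x∈⁅y⁆⇒x≡y a y∈ = inj₁ ≤-refl

  C∪⁅x⁆-chain : ∀ {C x} → IsChain C → (∀ y → y ∈ C → Comparable x y) → IsChain (C ∪ ⁅ x ⁆)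
  C∪⁅x⁆-chain {C} {x} C-chain x-comparable y z y∈ z∈ with x∈p∪⁅y⁆⁻ C y∈ | x∈p∪⁅y⁆⁻ C z∈
  ... | inj₁ y∈C  | inj₁ z∈C  = C-chain y z y∈C z∈C
  ... | inj₁ y∈C  | inj₂ refl = Sum.swap (x-comparable y y∈C)
  ... | inj₂ refl | inj₁ z∈C  = x-comparable z z∈C
  ... | inj₂ refl | inj₂ refl = inj₁ ≤-refl

  saturate : ∀ {C} → IsChain C → ∃[ D ] (C ⊆ D × IsChain D × Saturated D)
  saturate {C} = go C (⊃-wellFounded C)
    where
    go : ∀ C → Acc _⊃_ C → IsChain C → ∃[ D ] (C ⊆ D × IsChain D × Saturated D)
    go C (acc rs) C-chain with any? (λ x → ¬? (x ∈? C) ×-dec all? (λ y → y ∈? C →-dec (x ≤? y ⊎-dec y ≤? x)))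
    ... | yes (x , x∉C , x-comparable) =
      let D , C∪⁅x⁆⊆D , D-chain , D-saturated =
            go (C ∪ ⁅ x ⁆) (rs (p⊆p∪q ⁅ x ⁆ , x , x∈p∪q⁺ (inj₂ (x∈⁅x⁆ x)) , x∉C)) (C∪⁅x⁆-chain C-chain x-comparable)
      in D , C∪⁅x⁆⊆D ∘ p⊆p∪q ⁅ x ⁆ , D-chain , D-saturated
    ... | no ∄ = C , id , C-chain , C-saturated
      where
      C-saturated : Saturated C
      C-saturated x x-comparable with x ∈? C
      ... | yes x∈C = x∈C
      ... | no x∉C  = ⊥-elim (∄ (x , x∉C , x-comparable))

  maximalChain-through : ∀ {bot top} → IsBottom L bot → IsTop L top → ∀ a → ∃[ D ] (IsMaximalChainIn L bot top D × a ∈ D)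
  maximalChain-through bot-bottom top-top a =
    let D , ⁅a⁆⊆D , D-chain , D-saturated = saturate (⁅a⁆-chain a)
    in D , (((λ x _ → bot-bottom x , top-top x) , D-chain) , λ E (_ , E-chain) D⊆E {x} x∈E →
             D-saturated x (λ y y∈D → E-chain x y x∈E (D⊆E y∈D)))
         , ⁅a⁆⊆D (x∈⁅x⁆ a)

open FiniteLatticeProperties

_ᵒᵖ : FiniteLattice → FiniteLattice
L ᵒᵖ = record
  { size = size ; _≤_ = flip _≤_ ; _∨_ = _∧_ ; _∧_ = _∨_
  ; isLattice = ∧-∨-isLattice (record { isLattice = isLattice })
  }
  where open FiniteLattice L

joinIrreducibleᵒᵖ⇒meetIrreducible : ∀ L {x} → JoinIrreducible (L ᵒᵖ) x → MeetIrreducible L x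
joinIrreducibleᵒᵖ⇒meetIrreducible L (x-not-top , x-irreducible) =
  x-not-top , λ (y , z , (x≤y , x≢y) , (x≤z , x≢z) , x≡y∧z) → x-irreducible (y , z , (x≤y , x≢y ∘ sym) , (x≤z , x≢z ∘ sym) , x≡y∧z)

squeeze : ∀ {n r s u v} → u ≤ℕ suc r → r + v ≤ℕ suc n → v ≤ℕ suc s → s + u ≤ℕ suc n → u + v ≡ suc (suc n) → r + s ≡ n
squeeze {n} {r} {s} {u} {v} u≤1+r r+v≤1+n v≤1+s s+u≤1+n u+v≡2+n = ℕ.≤-antisym r+s≤n n≤r+s
  where
  open ℕ.≤-Reasoning
  r+s≤n : r + s ≤ℕ n
  r+s≤n = ℕ.+-cancelʳ-≤ (2 + n) (r + s) n (begin
    r + s + (2 + n)    ≡⟨ cong (r + s +_) (trans (ℕ.+-comm v u) u+v≡2+n) ⟨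
    r + s + (v + u)    ≡⟨ +-interchange r s v u ⟩
    r + v + (s + u)    ≤⟨ ℕ.+-mono-≤ r+v≤1+n s+u≤1+n ⟩
    suc n + suc n      ≡⟨ ℕ.+-suc n (suc n) ⟨
    n + (2 + n)        ∎)
  n≤r+s : n ≤ℕ r + s
  n≤r+s = s≤s⁻¹ (s≤s⁻¹ (begin
    2 + n              ≡⟨ u+v≡2+n ⟨
    u + v              ≤⟨ ℕ.+-mono-≤ u≤1+r v≤1+s ⟩
    suc r + suc s      ≡⟨ cong suc (ℕ.+-suc r s) ⟩
    2 + (r + s)        ∎))

rank+rankᵒᵖ≡n : ∀ L → Graded L → ∀ {C J M n} → IsMaximalChain L C → ∣ C ∣ ≡ suc n
  → (∀ j → JoinIrreducible L j → j ∈ J) → ∣ J ∣ ≡ n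
  → (∀ m → MeetIrreducible L m → m ∈ M) → ∣ M ∣ ≡ n
  → ∀ a → rank L J a + rank (L ᵒᵖ) M a ≡ n
rank+rankᵒᵖ≡n L graded {C} {J} {M} {n} (bot , top , bot-bottom , top-top , C-maximal) ∣C∣≡1+n JI⊆J ∣J∣≡n MI⊆M ∣M∣≡n a
  with maximalChain-through L bot-bottom top-top a
... | D , D-maximal@((_ , D-chain) , _) , a∈D = squeeze below above belowᵒᵖ aboveᵒᵖ below+above≡2+n
  where
  module L = FiniteLatticeProperties L
  module Lᵒᵖ = FiniteLatticeProperties (L ᵒᵖ)

  JIᵒᵖ⊆M : ∀ m → JoinIrreducible (L ᵒᵖ) m → m ∈ M
  JIᵒᵖ⊆M m = MI⊆M m ∘ joinIrreducibleᵒᵖ⇒meetIrreducible L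

  Dᵒᵖ-chain : Lᵒᵖ.IsChain D
  Dᵒᵖ-chain x y x∈D y∈D = Sum.swap (D-chain x y x∈D y∈D)

  ↓ᵒᵖa≡↑a : Lᵒᵖ.↓ a ≡ L.↑ a
  ↓ᵒᵖa≡↑a = ⟦P?⟧≡⟦Q?⟧ (Lᵒᵖ._≤? a) (a L.≤?_)

  ↑ᵒᵖa≡↓a : Lᵒᵖ.↑ a ≡ L.↓ a
  ↑ᵒᵖa≡↓a = ⟦P?⟧≡⟦Q?⟧ (a Lᵒᵖ.≤?_) (L._≤? a)

  below : ∣ D ∩ L.↓ a ∣ ≤ℕ suc (L.rank J a)
  below = L.∣C∩↓a∣≤1+rank JI⊆J D-chain a

  above : L.rank J a + ∣ D ∩ L.↑ a ∣ ≤ℕ suc n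
  above = subst (λ k → _ ≤ℕ suc k) ∣J∣≡n (L.rank+∣C∩↑a∣≤1+∣J∣ JI⊆J D-chain a)

  belowᵒᵖ : ∣ D ∩ L.↑ a ∣ ≤ℕ suc (Lᵒᵖ.rank M a)
  belowᵒᵖ = subst (λ X → ∣ D ∩ X ∣ ≤ℕ suc (Lᵒᵖ.rank M a)) ↓ᵒᵖa≡↑a (Lᵒᵖ.∣C∩↓a∣≤1+rank JIᵒᵖ⊆M Dᵒᵖ-chain a)

  aboveᵒᵖ : Lᵒᵖ.rank M a + ∣ D ∩ L.↓ a ∣ ≤ℕ suc n
  aboveᵒᵖ = subst₂ (λ X k → Lᵒᵖ.rank M a + ∣ D ∩ X ∣ ≤ℕ suc k) ↑ᵒᵖa≡↓a ∣M∣≡n (Lᵒᵖ.rank+∣C∩↑a∣≤1+∣J∣ JIᵒᵖ⊆M Dᵒᵖ-chain a)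

  below+above≡2+n : ∣ D ∩ L.↓ a ∣ + ∣ D ∩ L.↑ a ∣ ≡ suc (suc n)
  below+above≡2+n = trans (L.∣C∩↓a∣+∣C∩↑a∣≡1+∣C∣ D-chain a∈D) (cong suc (trans (graded bot top D C D-maximal C-maximal) ∣C∣≡1+n))

IsValuation : ∀ L → (Elt L → ℕ) → Set
IsValuation L v = ∀ a b → v (a ∨ b) + v (a ∧ b) ≡ v a + v b
  where open FiniteLattice L

complementary-supermodular⇒valuation : ∀ L {n} (r s : Elt L → ℕ) → (∀ a → r a + s a ≡ n)
  → Supermodular L r → Supermodular (L ᵒᵖ) s → IsValuation L r
complementary-supermodular⇒valuation L {n} r s r+s≡n r-super s-superᵒᵖ a b =
  ℕ.≤-antisym (ℕ.+-cancelʳ-≤ (s (a ∨ b) + s (a ∧ b)) _ _ (begin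
    r (a ∨ b) + r (a ∧ b) + (s (a ∨ b) + s (a ∧ b))   ≡⟨ +-interchange (r (a ∨ b)) _ _ _ ⟩
    r (a ∨ b) + s (a ∨ b) + (r (a ∧ b) + s (a ∧ b))   ≡⟨ cong₂ _+_ (r+s≡n (a ∨ b)) (r+s≡n (a ∧ b)) ⟩
    n + n                                             ≡⟨ cong₂ _+_ (r+s≡n a) (r+s≡n b) ⟨
    r a + s a + (r b + s b)                           ≡⟨ +-interchange (r a) _ _ _ ⟩
    r a + r b + (s a + s b)                           ≤⟨ ℕ.+-monoʳ-≤ (r a + r b) (s-superᵒᵖ a b) ⟩
    r a + r b + (s (a ∧ b) + s (a ∨ b))               ≡⟨ cong (r a + r b +_) (ℕ.+-comm (s (a ∧ b)) _) ⟩
    r a + r b + (s (a ∨ b) + s (a ∧ b))               ∎))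
  (r-super a b)
  where
  open FiniteLattice L
  open ℕ.≤-Reasoning

strictlyMonotoneValuation⇒¬N5 : ∀ L (v : Elt L → ℕ) → (∀ {a b} → _<_ L a b → v a <ℕ v b) → IsValuation L v
  → ¬ HasN5Sublattice L
strictlyMonotoneValuation⇒¬N5 L v v-strict v-valuation (f , f-injective , f-∨ , f-∧) = ℕ.<-irrefl vx≡vy (v-strict x<y)
  where
  open FiniteLattice L
  open IsLattice isLattice using (x≤x∨y)
  open ≡-Reasoning
  x<y : _<_ L (f nx) (f ny)
  x<y = subst (f nx ≤_) (sym (f-∨ nx ny)) (x≤x∨y (f nx) (f ny)) , (λ ()) ∘ f-injective
  vx≡vy : v (f nx) ≡ v (f ny)
  vx≡vy = ℕ.+-cancelʳ-≡ (v (f nz)) _ _ (begin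
    v (f nx) + v (f nz)                ≡⟨ v-valuation (f nx) (f nz) ⟨
    v (f nx ∨ f nz) + v (f nx ∧ f nz)  ≡⟨ cong₂ (λ p q → v p + v q) (f-∨ nx nz) (f-∧ nx nz) ⟨
    v (f n1) + v (f n0)                ≡⟨ cong₂ (λ p q → v p + v q) (f-∨ ny nz) (f-∧ ny nz) ⟩
    v (f ny ∨ f nz) + v (f ny ∧ f nz)  ≡⟨ v-valuation (f ny) (f nz) ⟩
    v (f ny) + v (f nz)                ∎)

lemma4 : (L : FiniteLattice) → Graded L → Trim L → ¬ HasN5Sublattice L
lemma4 L graded (n , (C , C-maximal , ∣C∣≡1+n , _) , (J , J-joinIrreducibles , ∣J∣≡n) , (M , M-meetIrreducibles , ∣M∣≡n)) =
  strictlyMonotoneValuation⇒¬N5 L (rank L J) (rank-strict L JI⊆J)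
    (complementary-supermodular⇒valuation L (rank L J) (rank (L ᵒᵖ) M)
      (rank+rankᵒᵖ≡n L graded C-maximal ∣C∣≡1+n JI⊆J ∣J∣≡n MI⊆M ∣M∣≡n)
      (rank-supermodular L J) (rank-supermodular (L ᵒᵖ) M))
  where
  JI⊆J : ∀ j → JoinIrreducible L j → j ∈ J
  JI⊆J j = proj₂ (J-joinIrreducibles j)
  MI⊆M : ∀ m → MeetIrreducible L m → m ∈ M
  MI⊆M m = proj₂ (M-meetIrreducibles m)
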